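{- Assume that $q=2$, or $q=4$ and $n>2$ is arbitrary, or $q$ is even and $n$ is odd. Then, even if we know the answer (a non-minority ball) to each of the $\binom{n}{q}$ possible queries of size $q$, it is possible that we cannot name a non-minority ball of the whole set of $n$ balls, i.e. there is a coloring and an admissible choice of answers such that no ball is a non-minority ball in every coloring consistent with the answers.
   Context: There are $n$ balls, each colored red or blue in an unknown way. A ball $b$ is a non-minority ball of a set $A$ of balls if at least $|A|/2$ balls of $A$ have the color of $b$. In this model a query is a set of $q$ balls, and the answer is (the index of) some non-minority ball of the query, chosen adversarially. -}

module Defs where

open import Data.Nat using (ℕ; _*_; _≤_; _<_)
open import Data.Bool using (Bool; _≟_)
open import Data.Fin using (Fin)
open import Data.Fin.Subset using (Subset; _∈_; _∩_; ∣_∣; ⊤)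
open import Data.Vec using (tabulate)
open import Data.Product using (_×_; Σ; ∃)
open import Relation.Nullary using (¬_; does)
open import Relation.Binary.PropositionalEquality using (_≡_)

Coloring : ℕ → Set
Coloring n = Fin n → Bool

sameColor : ∀ {n} → Coloring n → Fin n → Subset n
sameColor c b = tabulate (λ i → does (c i ≟ c b))

NonMinority : ∀ {n} → Coloring n → Subset n → Fin n → Set
NonMinority c A b = b ∈ A × ∣ A ∣ ≤ 2 * ∣ A ∩ sameColor c b ∣

-- An answer function assigns a ball to every query (only queries of size q matter).
Answers : ℕ → Set
Answers n = Subset n → Fin n

Admissible : ∀ {n} → ℕ → Coloring n → Answers n → Set
Admissible {n} q c ans = (Q : Subset n) → ∣ Q ∣ ≡ q → NonMinority c Q (ans Q)

Even Odd : ℕ → Set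
Even m = Σ ℕ (λ k → m ≡ 2 * k)
Odd m = Σ ℕ (λ k → m ≡ Data.Nat.suc (2 * k))

module Submission where

-- Partition the balls into classes by a labelling, every class
-- holding fewer than n/2 balls, and colour ball y "red iff y lies in class i";
-- call this the class colouring of i.  If every query Q of size q contains a
-- ball x whose class holds at least q/2 balls of Q, answer Q by such an x.
-- This answer is non-minority in Q under EVERY class colouring: the balls of
-- x's class always share x's colour.  So the answers are admissible for all
-- class colourings at once, yet ball b is a minority ball of the whole set
-- under the colouring of its own class.  (Module Partition.)
--
-- It remains to choose the partition.  For q = 2 take singleton classes.
-- Otherwise take three consecutive blocks of sizes a, b, c (module Blocks),
-- where it suffices that each size is below n/2 and that every split of q
-- into at most a, b and c balls has a part of at least q/2 balls: sizes
-- m, m, 1 when n = 2m+1 and q is even (this also covers q = 4, n odd), and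
-- sizes t, t, 2 when n = 2t+2 and q = 4.  The splitting conditions follow
-- from the arithmetic lemma halfSplit.

open import Defs
open import Data.Nat using (ℕ; zero; suc; _+_; _*_; _≤_; _<_; _>_; z≤n; s≤s; _≤?_)
open import Data.Nat.Tactic.RingSolver using (solve-∀)
open import Data.Nat.Properties
  using (≤-trans; ≤-pred; ≤-<-trans; <-≤-trans; <-irrefl; ≤-<-connex; n<1+n; +-suc; +-identityʳ;
         +-mono-≤; +-monoʳ-≤; *-monoʳ-≤; *-monoʳ-<; *-cancelˡ-<; module ≤-Reasoning)
open import Data.Fin using (Fin; zero; suc; _≟_; fromℕ<)
open import Data.Fin.Properties using (any?)
open import Data.Fin.Subset using (Subset; _∈_; _⊆_; _∩_; ∣_∣; ⊤; ⁅_⁆; Nonempty; inside; outside)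
open import Data.Fin.Subset.Properties
  using (_∈?_; x∈p∩q⁺; x∈p∩q⁻; p⊆q⇒∣p∣≤∣q∣; ∣p∩q∣≤∣q∣; ∣⊤∣≡n; ∣⁅x⁆∣≡1; x∈⁅x⁆; x∈p⇒∣p-x∣<∣p∣)
open import Data.Bool using (Bool; true; false; if_then_else_)
import Data.Bool as Bool
open import Data.Vec using (Vec; []; _∷_; tabulate; lookup; replicate; _++_; here; there)
open import Data.Vec.Properties using (lookup∘tabulate; []=⇒lookup; lookup⇒[]=)
open import Data.Product using (_×_; _,_; ∃)
open import Data.Sum using (_⊎_; inj₁; inj₂; map₂)
open import Data.Empty using (⊥-elim)
open import Relation.Nullary using (¬_; Dec; yes; no; does)
open import Relation.Nullary.Decidable using (dec-true; _×-dec_)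
open import Relation.Binary.PropositionalEquality using (_≡_; refl; sym; trans; cong; cong₂; subst)

-- The conclusion of the theorem: a colouring with admissible answers under
-- which no ball is certified non-minority in the whole set, since each ball
-- b is a minority ball under some colouring for which the answers are also
-- admissible.
Unnameable : ℕ → ℕ → Set
Unnameable n q =
  ∃ λ (c : Coloring n) → ∃ λ (ans : Answers n) →
    Admissible q c ans ×
    ((b : Fin n) → ∃ λ (c′ : Coloring n) → Admissible q c′ ans × ¬ NonMinority c′ ⊤ b)

does-true⇒ : ∀ {A : Set} (a? : Dec A) → does a? ≡ true → A
does-true⇒ (yes a) _ = a

∈-tabulate⁺ : ∀ {n} (f : Fin n → Bool) {x : Fin n} → f x ≡ true → x ∈ tabulate f
∈-tabulate⁺ f {x} fx = lookup⇒[]= x (tabulate f) (trans (lookup∘tabulate f x) fx)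

∈-tabulate⁻ : ∀ {n} (f : Fin n → Bool) {x : Fin n} → x ∈ tabulate f → f x ≡ true
∈-tabulate⁻ f {x} x∈ = trans (sym (lookup∘tabulate f x)) ([]=⇒lookup x∈)

∈-sameColor⁻ : ∀ {n} (c : Coloring n) {b y : Fin n} → y ∈ sameColor c b → c y ≡ c b
∈-sameColor⁻ c {b} {y} y∈ = does-true⇒ (c y Bool.≟ c b) (∈-tabulate⁻ _ y∈)

∈-sameColor⁺ : ∀ {n} (c : Coloring n) {b y : Fin n} → c y ≡ c b → y ∈ sameColor c b
∈-sameColor⁺ c {b} {y} e = ∈-tabulate⁺ _ (dec-true (c y Bool.≟ c b) e)

positive⇒nonempty : ∀ {n} (p : Subset n) → 0 < ∣ p ∣ → Nonempty p
positive⇒nonempty (inside ∷ p) _ = zero , here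
positive⇒nonempty (outside ∷ p) 0<∣p∣ with positive⇒nonempty p 0<∣p∣
... | x , x∈p = suc x , there x∈p

∩-monoʳ-⊆ : ∀ {n} (Q : Subset n) {p r : Subset n} → p ⊆ r → Q ∩ p ⊆ Q ∩ r
∩-monoʳ-⊆ Q {p} p⊆r y∈ with x∈p∩q⁻ Q p y∈
... | y∈Q , y∈p = x∈p∩q⁺ (y∈Q , p⊆r y∈p)

module Partition {n k : ℕ} (lab : Fin n → Fin k) where

  classColoring : Fin k → Coloring n
  classColoring i y = does (lab y ≟ i)

  class : Fin k → Subset n
  class i = tabulate (classColoring i)

  ∈-class⁺ : ∀ {i y} → lab y ≡ i → y ∈ class i
  ∈-class⁺ {i} {y} e = ∈-tabulate⁺ (classColoring i) (dec-true (lab y ≟ i) e)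

  ∈-class⁻ : ∀ {i y} → y ∈ class i → lab y ≡ i
  ∈-class⁻ {i} {y} y∈ = does-true⇒ (lab y ≟ i) (∈-tabulate⁻ (classColoring i) y∈)

  class⊆sameColor : ∀ i x → class (lab x) ⊆ sameColor (classColoring i) x
  class⊆sameColor i x y∈ =
    ∈-sameColor⁺ (classColoring i) (cong (λ l → does (l ≟ i)) (∈-class⁻ y∈))

  sameColor⊆class : ∀ x → sameColor (classColoring (lab x)) x ⊆ class (lab x)
  sameColor⊆class x y∈ =
    ∈-tabulate⁺ (classColoring (lab x))
      (trans (∈-sameColor⁻ (classColoring (lab x)) y∈) (dec-true (lab x ≟ lab x) refl))

  HeavyBall : ℕ → Subset n → Fin n → Set
  HeavyBall q Q x = x ∈ Q × q ≤ 2 * ∣ Q ∩ class (lab x) ∣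

  heavyClass⇒heavyBall : ∀ {q} Q j → 0 < q → q ≤ 2 * ∣ Q ∩ class j ∣ → ∃ (HeavyBall q Q)
  heavyClass⇒heavyBall {q} Q j 0<q heavy
    with positive⇒nonempty (Q ∩ class j) (positive (∣ Q ∩ class j ∣) heavy)
    where
    positive : ∀ m → q ≤ 2 * m → 0 < m
    positive zero q≤0 = ⊥-elim (<-irrefl refl (<-≤-trans 0<q q≤0))
    positive (suc m) _ = s≤s z≤n
  ... | x , x∈ with x∈p∩q⁻ Q (class j) x∈
  ... | x∈Q , x∈class = x , x∈Q , subst (λ l → q ≤ 2 * ∣ Q ∩ class l ∣) (sym (∈-class⁻ x∈class)) heavy

  answer : ℕ → Fin n → Answers n
  answer q d Q with any? (λ x → (x ∈? Q) ×-dec (q ≤? 2 * ∣ Q ∩ class (lab x) ∣))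
  ... | yes (x , _) = x
  ... | no _ = d

  answer-heavy : ∀ q d Q → ∃ (HeavyBall q Q) → HeavyBall q Q (answer q d Q)
  answer-heavy q d Q heavy with any? (λ x → (x ∈? Q) ×-dec (q ≤? 2 * ∣ Q ∩ class (lab x) ∣))
  ... | yes (_ , isHeavy) = isHeavy
  ... | no noHeavy = ⊥-elim (noHeavy heavy)

  heavy⇒nonMinority : ∀ {q Q x} i → ∣ Q ∣ ≡ q → HeavyBall q Q x → NonMinority (classColoring i) Q x
  heavy⇒nonMinority {q} {Q} {x} i ∣Q∣≡q (x∈Q , heavy) =
    x∈Q ,
    subst (_≤ 2 * ∣ Q ∩ sameColor (classColoring i) x ∣) (sym ∣Q∣≡q)
      (≤-trans heavy (*-monoʳ-≤ 2 (p⊆q⇒∣p∣≤∣q∣ (∩-monoʳ-⊆ Q (class⊆sameColor i x)))))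

  minority : ∀ b → 2 * ∣ class (lab b) ∣ < n → ¬ NonMinority (classColoring (lab b)) ⊤ b
  minority b small (_ , half) = <-irrefl refl (begin-strict
    n                                                 ≡⟨ sym (∣⊤∣≡n n) ⟩
    ∣ ⊤ {n} ∣                                         ≤⟨ half ⟩
    2 * ∣ ⊤ ∩ sameColor (classColoring (lab b)) b ∣   ≤⟨ *-monoʳ-≤ 2 (∣p∩q∣≤∣q∣ ⊤ (sameColor (classColoring (lab b)) b)) ⟩
    2 * ∣ sameColor (classColoring (lab b)) b ∣       ≤⟨ *-monoʳ-≤ 2 (p⊆q⇒∣p∣≤∣q∣ (sameColor⊆class b)) ⟩
    2 * ∣ class (lab b) ∣                             <⟨ small ⟩
    n                                                 ∎)
    where open ≤-Reasoning

  unnameable : ∀ q → Fin n → (∀ i → 2 * ∣ class i ∣ < n) →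
               (∀ Q → ∣ Q ∣ ≡ q → ∃ (HeavyBall q Q)) → Unnameable n q
  unnameable q d small covered =
    classColoring (lab d) , answer q d , admissible (lab d) ,
    λ b → classColoring (lab b) , admissible (lab b) , minority b (small (lab b))
    where
    admissible : ∀ i → Admissible q (classColoring i) (answer q d)
    admissible i Q ∣Q∣≡q = heavy⇒nonMinority i ∣Q∣≡q (answer-heavy q d Q (covered Q ∣Q∣≡q))

classOf : ∀ {n k} → Vec (Fin k) n → Fin k → Subset n
classOf L = Partition.class (lookup L)

∣classOf-++∣ : ∀ {k m n} (xs : Vec (Fin k) m) (ys : Vec (Fin k) n) i →
               ∣ classOf (xs ++ ys) i ∣ ≡ ∣ classOf xs i ∣ + ∣ classOf ys i ∣
∣classOf-++∣ [] ys i = refl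
∣classOf-++∣ (x ∷ xs) ys i with does (x ≟ i)
... | true = cong suc (∣classOf-++∣ xs ys i)
... | false = ∣classOf-++∣ xs ys i

∣classOf-replicate∣ : ∀ {k} m (l i : Fin k) →
                      ∣ classOf (replicate m l) i ∣ ≡ (if does (l ≟ i) then m else 0)
∣classOf-replicate∣ zero l i with does (l ≟ i)
... | true = refl
... | false = refl
∣classOf-replicate∣ (suc m) l i with does (l ≟ i) | ∣classOf-replicate∣ m l i
... | true | ih = cong suc ih
... | false | ih = ih

∣∩classOf∣-sum : ∀ {n} (L : Vec (Fin 3) n) (Q : Subset n) →
                 ∣ Q ∩ classOf L zero ∣ + ∣ Q ∩ classOf L (suc zero) ∣ + ∣ Q ∩ classOf L (suc (suc zero)) ∣ ≡ ∣ Q ∣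
∣∩classOf∣-sum [] [] = refl
∣∩classOf∣-sum (l ∷ L) (outside ∷ Q) = ∣∩classOf∣-sum L Q
∣∩classOf∣-sum (zero ∷ L) (inside ∷ Q) = cong suc (∣∩classOf∣-sum L Q)
∣∩classOf∣-sum (suc zero ∷ L) (inside ∷ Q) =
  trans (cong (_+ ∣ Q ∩ classOf L (suc (suc zero)) ∣) (+-suc ∣ Q ∩ classOf L zero ∣ _))
        (cong suc (∣∩classOf∣-sum L Q))
∣∩classOf∣-sum (suc (suc zero) ∷ L) (inside ∷ Q) =
  trans (+-suc (∣ Q ∩ classOf L zero ∣ + ∣ Q ∩ classOf L (suc zero) ∣) _)
        (cong suc (∣∩classOf∣-sum L Q))

module Blocks (a b c : ℕ) where

  blocks : Vec (Fin 3) (a + (b + c))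
  blocks = replicate a zero ++ replicate b (suc zero) ++ replicate c (suc (suc zero))

  ∣block∣ : ∀ i → ∣ classOf blocks i ∣ ≡
            (if does (zero ≟ i) then a else 0) + ((if does (suc zero ≟ i) then b else 0) +
                                                 (if does (suc (suc zero) ≟ i) then c else 0))
  ∣block∣ i =
    trans (∣classOf-++∣ (replicate a zero) _ i)
      (cong₂ _+_ (∣classOf-replicate∣ a zero i)
        (trans (∣classOf-++∣ (replicate b (suc zero)) _ i)
          (cong₂ _+_ (∣classOf-replicate∣ b (suc zero) i) (∣classOf-replicate∣ c (suc (suc zero)) i))))

  ∣block₀∣ : ∣ classOf blocks zero ∣ ≡ a
  ∣block₀∣ = trans (∣block∣ zero) (+-identityʳ a)

  ∣block₁∣ : ∣ classOf blocks (suc zero) ∣ ≡ b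
  ∣block₁∣ = trans (∣block∣ (suc zero)) (+-identityʳ b)

  ∣block₂∣ : ∣ classOf blocks (suc (suc zero)) ∣ ≡ c
  ∣block₂∣ = ∣block∣ (suc (suc zero))

  open Partition (lookup blocks)

  blocksUnnameable : ∀ {n} q → a + (b + c) ≡ n → 0 < q →
    2 * a < n → 2 * b < n → 2 * c < n →
    (∀ x y z → x + y + z ≡ q → x ≤ a → y ≤ b → z ≤ c → q ≤ 2 * x ⊎ q ≤ 2 * y ⊎ q ≤ 2 * z) →
    Unnameable n q
  blocksUnnameable q refl 0<q smallA smallB smallC split =
    unnameable q (fromℕ< (≤-<-trans z≤n smallA)) small covered
    where
    small : ∀ i → 2 * ∣ class i ∣ < a + (b + c)
    small zero = subst (λ s → 2 * s < a + (b + c)) (sym ∣block₀∣) smallA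
    small (suc zero) = subst (λ s → 2 * s < a + (b + c)) (sym ∣block₁∣) smallB
    small (suc (suc zero)) = subst (λ s → 2 * s < a + (b + c)) (sym ∣block₂∣) smallC

    part≤ : ∀ Q i → ∣ Q ∩ class i ∣ ≤ ∣ class i ∣
    part≤ Q i = ∣p∩q∣≤∣q∣ Q (class i)

    covered : ∀ Q → ∣ Q ∣ ≡ q → ∃ (HeavyBall q Q)
    covered Q ∣Q∣≡q
      with split (∣ Q ∩ class zero ∣) (∣ Q ∩ class (suc zero) ∣) (∣ Q ∩ class (suc (suc zero)) ∣)
                 (trans (∣∩classOf∣-sum blocks Q) ∣Q∣≡q)
                 (subst (∣ Q ∩ class zero ∣ ≤_) ∣block₀∣ (part≤ Q zero))
                 (subst (∣ Q ∩ class (suc zero) ∣ ≤_) ∣block₁∣ (part≤ Q (suc zero)))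
                 (subst (∣ Q ∩ class (suc (suc zero)) ∣ ≤_) ∣block₂∣ (part≤ Q (suc (suc zero))))
    ... | inj₁ heavy = heavyClass⇒heavyBall Q zero 0<q heavy
    ... | inj₂ (inj₁ heavy) = heavyClass⇒heavyBall Q (suc zero) 0<q heavy
    ... | inj₂ (inj₂ heavy) = heavyClass⇒heavyBall Q (suc (suc zero)) 0<q heavy

halfSplit : ∀ h x y z → x + y + z ≡ 2 * h → z ≤ 1 → 2 * h ≤ 2 * x ⊎ 2 * h ≤ 2 * y
halfSplit h x y z sum z≤1 with ≤-<-connex (2 * h) (2 * x) | ≤-<-connex (2 * h) (2 * y)
... | inj₁ heavyX | _ = inj₁ heavyX
... | inj₂ _ | inj₁ heavyY = inj₂ heavyY
... | inj₂ lightX | inj₂ lightY = ⊥-elim (<-irrefl refl (begin-strict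
  2 * h               ≡⟨ sym sum ⟩
  x + y + z           ≤⟨ +-monoʳ-≤ (x + y) z≤1 ⟩
  x + y + 1           ≡⟨ +-suc (x + y) 0 ⟩
  suc (x + y + 0)     ≡⟨ cong suc (+-identityʳ (x + y)) ⟩
  suc (x + y)         <⟨ n<1+n _ ⟩
  suc (suc (x + y))   ≡⟨ cong suc (sym (+-suc x y)) ⟩
  suc x + suc y       ≤⟨ +-mono-≤ (*-cancelˡ-< 2 x h lightX) (*-cancelˡ-< 2 y h lightY) ⟩
  h + h               ≡⟨ cong (h +_) (sym (+-identityʳ h)) ⟩
  2 * h               ∎))
  where open ≤-Reasoning

even⊎odd : ∀ n → Even n ⊎ Odd n
even⊎odd zero = inj₁ (0 , refl)
even⊎odd (suc n) with even⊎odd n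
... | inj₁ (k , refl) = inj₂ (k , refl)
... | inj₂ (k , refl) = inj₁ (suc k , cong suc (sym (+-suc k (k + 0))))

pairQueries : ∀ n → 2 < n → Unnameable n 2
pairQueries (suc n) 2<n = unnameable 2 zero small covered
  where
  open Partition {suc n} (λ y → y)

  small : ∀ i → 2 * ∣ class i ∣ < suc n
  small i = ≤-<-trans (*-monoʳ-≤ 2 (≤-trans (p⊆q⇒∣p∣≤∣q∣ class⊆⁅i⁆) (subst (_≤ 1) (sym (∣⁅x⁆∣≡1 i)) (s≤s z≤n)))) 2<n
    where
    class⊆⁅i⁆ : class i ⊆ ⁅ i ⁆
    class⊆⁅i⁆ y∈ = subst (_∈ ⁅ i ⁆) (sym (∈-class⁻ y∈)) (x∈⁅x⁆ i)

  covered : ∀ Q → ∣ Q ∣ ≡ 2 → ∃ (HeavyBall 2 Q)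
  covered Q ∣Q∣≡2 with positive⇒nonempty Q (subst (0 <_) (sym ∣Q∣≡2) (s≤s z≤n))
  ... | x , x∈Q =
    x , x∈Q , *-monoʳ-≤ 2 (≤-<-trans z≤n (x∈p⇒∣p-x∣<∣p∣ (x∈p∩q⁺ (x∈Q , ∈-class⁺ refl))))

oddLength : ∀ m → m + (m + 1) ≡ suc (2 * m)
oddLength = solve-∀

evenLength : ∀ t → t + (t + 2) ≡ 2 * suc t
evenLength = solve-∀

evenQueriesOddBalls : ∀ {n q} → 0 < q → q < n → Even q → Odd n → Unnameable n q
evenQueriesOddBalls {q = q} 0<q q<n (h , refl) (m , refl) =
  blocksUnnameable q (oddLength m) 0<q
    (n<1+n _) (n<1+n _) (≤-trans (s≤s (*-monoʳ-≤ 2 (positive h 0<q))) q<n)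
    λ x y z sum _ _ z≤1 → map₂ inj₁ (halfSplit h x y z sum z≤1)
  where
  open Blocks m m 1
  positive : ∀ h → 0 < 2 * h → 1 ≤ h
  positive zero ()
  positive (suc _) _ = s≤s z≤n

fourQueriesEvenBalls : ∀ {n} → 4 < n → Even n → Unnameable n 4
fourQueriesEvenBalls 4<n (suc t , refl) =
  blocksUnnameable 4 (evenLength t) (s≤s z≤n)
    (*-monoʳ-< 2 (n<1+n t)) (*-monoʳ-< 2 (n<1+n t)) 4<n split
  where
  open Blocks t t 2
  split : ∀ x y z → x + y + z ≡ 4 → x ≤ t → y ≤ t → z ≤ 2 → 4 ≤ 2 * x ⊎ 4 ≤ 2 * y ⊎ 4 ≤ 2 * z
  split x y z sum _ _ _ with ≤-<-connex 4 (2 * z)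
  ... | inj₁ heavyZ = inj₂ (inj₂ heavyZ)
  ... | inj₂ lightZ = map₂ inj₁ (halfSplit 2 x y z sum (≤-pred (*-cancelˡ-< 2 z 2 lightZ)))

lemma15 : (n q : ℕ) → 0 < q → q < n →
          (q ≡ 2 ⊎ (q ≡ 4 × n > 2) ⊎ (Even q × Odd n)) →
          ∃ λ (c : Coloring n) → ∃ λ (ans : Answers n) →
            Admissible q c ans ×
            ((b : Fin n) → ∃ λ (c′ : Coloring n) →
               Admissible q c′ ans × ¬ NonMinority c′ ⊤ b)
lemma15 n q _ q<n (inj₁ refl) = pairQueries n q<n
lemma15 n q 0<q q<n (inj₂ (inj₂ (evenQ , oddN))) = evenQueriesOddBalls 0<q q<n evenQ oddN
lemma15 n q 0<q q<n (inj₂ (inj₁ (refl , _))) with even⊎odd n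
... | inj₁ evenN = fourQueriesEvenBalls q<n evenN
... | inj₂ oddN = evenQueriesOddBalls 0<q q<n (2 , refl) oddN
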